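{- The formula $\bigwedge_{u\in H}\bigwedge_{z\in Z_u}\bigwedge_{h\in H}\big(A(\overline z\rightarrow\overline h)\rightarrow A(\overline h\rightarrow\overline z)\big)$ is not valid in preference-sight models: there exists a preference-sight tree $(T,s)$ whose preference-sight model does not validate it.
   Context: Preference trees: $T=(H,\succeq)$, $H$ a nonempty prefix-closed set of finite action sequences (histories) containing the empty sequence, $\succeq$ a total (complete, transitive) preference relation on $H$. $h\lhd h'$: $h$ is a prefix of $h'$ (reflexive); $H|_h$: histories extending $h$. A sight function assigns to each $h$ a nonempty finite $s(h)\subseteq H|_h$ with (DC) $h\lhd h'\lhd h''$, $h''\in s(h)\Rightarrow h'\in s(h)$ and (NF) $h\lhd h'\lhd h''$, $h''\in s(h)\Rightarrow h''\in s(h')$; $(T,s)$ is a preference-sight tree. $Z_u$: elements of $s(u)$ with no proper extension in $s(u)$. Logic: atoms $\overline{h}$, $\overline{h_1\geq h_2}$, $\overline{s(h)}$ for histories; formulas built with $\neg,\wedge$, $[!\varphi]\psi$, $A\varphi$. The preference-sight model is $M=(H,\lhd,\mathcal V)$ with $\mathcal V(\overline h)=\{h':h'\lhd h\}$, $\mathcal V(\overline{h_1\geq h_2})=H$ if $h_1\succeq h_2$ and $\emptyset$ otherwise, $\mathcal V(\overline{s(h)})=\bigcup_{h'\in s(h)}\mathcal V(\overline{h'})$. Booleans standard; $A\varphi$ holds at a world iff $\varphi$ holds at every world of $M$. Valid in $M$: true at all worlds. -}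

module Defs where

open import Level using (0ℓ)
open import Data.List using (List; []; _++_)
open import Data.List.Membership.Propositional using (_∈_)
open import Data.Product using (Σ; ∃; _×_; _,_)
open import Data.Sum using (_⊎_)
open import Data.Empty using (⊥)
open import Relation.Nullary using (¬_)
open import Relation.Binary.PropositionalEquality using (_≡_)

_⊲_ : {Act : Set} → List Act → List Act → Set
h ⊲ h' = ∃ λ t → h ++ t ≡ h'

-- A preference-sight tree (T , s) over an arbitrary set of actions.
-- H is given as a predicate on finite action sequences; s(h) is a finite
-- (list-represented) set of histories.
record PrefSightTree : Set₁ where
  field
    Act      : Set
    H        : List Act → Set
    H-[]     : H []
    H-prefix : ∀ {h h'} → h ⊲ h' → H h' → H h
    _≽_      : List Act → List Act → Set
    ≽-total  : ∀ {h h'} → H h → H h' → (h ≽ h') ⊎ (h' ≽ h)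
    ≽-trans  : ∀ {h₁ h₂ h₃} → H h₁ → H h₂ → H h₃ → h₁ ≽ h₂ → h₂ ≽ h₃ → h₁ ≽ h₃
    s        : List Act → List (List Act)
    s-nonempty : ∀ {h} → H h → ∃ λ h' → h' ∈ s h
    s-sub    : ∀ {h h'} → H h → h' ∈ s h → H h' × (h ⊲ h')
    s-DC     : ∀ {h h' h''} → H h → h ⊲ h' → h' ⊲ h'' → h'' ∈ s h → h' ∈ s h
    s-NF     : ∀ {h h' h''} → H h → h ⊲ h' → h' ⊲ h'' → h'' ∈ s h → h'' ∈ s h'

data Formula (Act : Set) : Set where
  hist : List Act → Formula Act
  pref : List Act → List Act → Formula Act
  sight : List Act → Formula Act
  ¬′_  : Formula Act → Formula Act
  _∧′_ : Formula Act → Formula Act → Formula Act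
  [!_]_ : Formula Act → Formula Act → Formula Act
  A_   : Formula Act → Formula Act

_⇒′_ : {Act : Set} → Formula Act → Formula Act → Formula Act
φ ⇒′ ψ = ¬′ (φ ∧′ (¬′ ψ))

module _ (T : PrefSightTree) where
  open PrefSightTree T

  -- Truth in the (possibly announcement-restricted) preference-sight model
  -- whose set of worlds is D (initially D = H), at world w.
  sat : (List Act → Set) → List Act → Formula Act → Set
  sat D w (hist h)     = w ⊲ h
  sat D w (pref h₁ h₂) = h₁ ≽ h₂
  sat D w (sight h)    = ∃ λ h' → (h' ∈ s h) × (w ⊲ h')
  sat D w (¬′ φ)       = ¬ sat D w φ
  sat D w (φ ∧′ ψ)     = sat D w φ × sat D w ψ
  sat D w ([! φ ] ψ)   = sat D w φ → sat (λ v → D v × sat D v φ) w ψ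
  sat D w (A φ)        = ∀ v → D v → sat D v φ

  InZ : List Act → List Act → Set
  InZ u z = z ∈ s u × (∀ z' → z' ∈ s u → z ⊲ z' → z' ≡ z)

  Ψ : List Act → List Act → Formula Act
  Ψ z h = (A (hist z ⇒′ hist h)) ⇒′ (A (hist h ⇒′ hist z))

  -- Truth at w of the (possibly infinitary) conjunction
  -- ⋀_{u∈H} ⋀_{z∈Z_u} ⋀_{h∈H} Ψ z h.
  satBig : List Act → Set
  satBig w = ∀ u → H u → ∀ z → InZ u z → ∀ h → H h → sat H w (Ψ z h)

  ValidBig : Set
  ValidBig = ∀ w → H w → satBig w

-- Take all finite sequences over a one-letter alphabet and let every history see only itself.
-- Then the root z = [] lies in Z_[], and h = [a] strictly extends it: every world below z
-- lies below h, so A(z̄ → h̄) holds, but the world h itself refutes A(h̄ → z̄).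
module Submission where

open import Defs
open import Data.Product using (Σ; _,_)
open import Relation.Nullary using (¬_)
open import Data.List using (List; []; _∷_; _++_)
open import Data.List.Properties using (++-identityʳ; ++-identityʳ-unique; ++-conicalˡ; ++-assoc)
open import Data.List.Relation.Unary.Any using (here)
open import Data.Unit using (⊤; tt)
open import Data.Sum using (inj₁)
open import Relation.Binary.PropositionalEquality using (_≡_; refl; sym; trans)

module _ {Act : Set} where

  ⊲-refl : (h : List Act) → h ⊲ h
  ⊲-refl h = [] , ++-identityʳ h

  []-⊲ : (h : List Act) → [] ⊲ h
  []-⊲ h = h , refl

  ∷-⋪-[] : ∀ {a : Act} {h} → ¬ (a ∷ h) ⊲ []
  ∷-⋪-[] (_ , ())

  ⊲-trans : ∀ {h₁ h₂ h₃ : List Act} → h₁ ⊲ h₂ → h₂ ⊲ h₃ → h₁ ⊲ h₃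
  ⊲-trans {h₁} (t , refl) (t' , refl) = t ++ t' , sym (++-assoc h₁ t t')

  ⊲-antisym : ∀ {h h' : List Act} → h ⊲ h' → h' ⊲ h → h' ≡ h
  ⊲-antisym {h} (t , refl) (t' , e) with ++-conicalˡ t t' (++-identityʳ-unique h (sym (trans (sym (++-assoc h t t')) e)))
  ... | refl = ++-identityʳ h

Ψ-strict-extension-fails : (T : PrefSightTree) → let open PrefSightTree T in
  ∀ {w z h} → H h → z ⊲ h → ¬ h ⊲ z → ¬ sat T H w (Ψ T z h)
Ψ-strict-extension-fails T {z = z} {h} Hh z⊲h h⋪z Ψ-holds =
  Ψ-holds (z-below-h , h-not-below-z)
  where
  open PrefSightTree T using (H)
  z-below-h : sat T H z (A (hist z ⇒′ hist h))
  z-below-h v _ (v⊲z , v⋪h) = v⋪h (⊲-trans v⊲z z⊲h)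
  h-not-below-z : ¬ sat T H z (A (hist h ⇒′ hist z))
  h-not-below-z all-below = all-below h Hh (⊲-refl h , h⋪z)

selfSightTree : Set → PrefSightTree
selfSightTree Act = record
  { Act = Act
  ; H = λ _ → ⊤
  ; H-[] = tt
  ; H-prefix = λ _ _ → tt
  ; _≽_ = λ _ _ → ⊤
  ; ≽-total = λ _ _ → inj₁ tt
  ; ≽-trans = λ _ _ _ _ _ → tt
  ; s = λ h → h ∷ []
  ; s-nonempty = λ {h} _ → h , here refl
  ; s-sub = λ { {h} _ (here refl) → tt , ⊲-refl h }
  ; s-DC = λ { _ h⊲h' h'⊲h (here refl) → here (⊲-antisym h⊲h' h'⊲h) }
  ; s-NF = λ { _ h⊲h' h'⊲h (here refl) → here (sym (⊲-antisym h⊲h' h'⊲h)) }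
  }

selfSight-InZ : (Act : Set) (h : List Act) → InZ (selfSightTree Act) h h
selfSight-InZ Act h = here refl , λ { _ (here refl) _ → refl }

mainTheorem9 : Σ PrefSightTree (λ T → ¬ ValidBig T)
mainTheorem9 = selfSightTree ⊤ , λ valid →
  Ψ-strict-extension-fails (selfSightTree ⊤) {w = []} tt ([]-⊲ (tt ∷ [])) ∷-⋪-[]
    (valid [] tt [] tt [] (selfSight-InZ ⊤ []) (tt ∷ []) tt)
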